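{- For every integer $n\ge 2$, $\gamma(cDB(n,n,n))=\lceil n/3\rceil\,(n-1)!$.
   Context: Let $[d]=\{1,\dots,d\}$. A sequence $(x_1,\dots,x_n)\in[d]^n$ is $t$-constrained if for all $1\le i<j\le n$ with $x_i=x_j$ one has $j-i\ge t$; thus $V(n,n,n)$, the set of $n$-constrained sequences in $[n]^n$, is the set of permutations of $[n]$. The directed graph $cDB^+(d,t,n)$ has vertex set $V(d,t,n)$ and an arc from $(a_1,\dots,a_n)$ to $(a_2,\dots,a_n,a_{n+1})$ whenever both lie in $V(d,t,n)$; $cDB(d,t,n)$ is its undirected version, obtained by ignoring arc directions and removing loops and multiple edges. In an undirected graph a vertex dominates itself and its neighbours; a dominating set is a set $S$ of vertices such that every vertex is dominated by some vertex of $S$, and $\gamma(G)$ is the minimum size of a dominating set. -}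

module Defs where

open import Data.Nat using (ℕ; suc; _≤_; _<_; _∸_)
open import Data.Fin using (Fin; toℕ)
open import Data.Vec using (Vec; lookup)
open import Data.List using (List; length)
open import Data.List.Membership.Propositional using (_∈_)
open import Data.List.Relation.Unary.Unique.Propositional using (Unique)
open import Data.Product using (_×_; ∃-syntax)
open import Data.Sum using (_⊎_)
open import Relation.Binary.PropositionalEquality using (_≡_; _≢_)

-- Sequences (x_1,…,x_n) ∈ [d]^n, with [d] represented by Fin d.
Seq : ℕ → ℕ → Set
Seq d n = Vec (Fin d) n

TConstrained : ∀ {d n} → ℕ → Seq d n → Set
TConstrained {d} {n} t x =
  (i j : Fin n) → toℕ i < toℕ j → lookup x i ≡ lookup x j → t ≤ toℕ j ∸ toℕ i

InV : (d t n : ℕ) → Seq d n → Set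
InV d t n x = TConstrained t x

-- arc of cDB⁺(d,t,n) from a to b: both in V(d,t,n) and
-- b = (a_2,…,a_n,b_n), i.e. b_j = a_{j+1} for all j < n.
Arc : (d t n : ℕ) → Seq d n → Seq d n → Set
Arc d t n a b = InV d t n a × InV d t n b ×
  ((i j : Fin n) → suc (toℕ j) ≡ toℕ i → lookup a i ≡ lookup b j)

Adj : (d t n : ℕ) → Seq d n → Seq d n → Set
Adj d t n u v = u ≢ v × (Arc d t n u v ⊎ Arc d t n v u)

Dominating : (d t n : ℕ) → List (Seq d n) → Set
Dominating d t n S =
  ((s : Seq d n) → s ∈ S → InV d t n s) ×
  ((w : Seq d n) → InV d t n w → ∃[ s ] (s ∈ S × (s ≡ w ⊎ Adj d t n s w)))

DominationNumber : (d t n : ℕ) → ℕ → Set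
DominationNumber d t n k =
  (∃[ S ] (Unique S × Dominating d t n S × length S ≡ k)) ×
  ((S : List (Seq d n)) → Unique S → Dominating d t n S → k ≤ length S)

-- A sequence in V(n,n,n) is a permutation of [n], and since a permutation of length n uses every
-- symbol, the symbol appended by an arc is forced: it is the one just dropped. So the arcs of
-- cDB⁺(n,n,n) are exactly the cyclic rotations, and cDB(n,n,n) is a disjoint union of (n-1)! cycles
-- of length n (single edges when n = 2), one through each permutation that starts with its least
-- symbol. Every closed neighbourhood of a cycle has at most 3 vertices, so a dominating set meets
-- each cycle in at least ⌈n/3⌉ vertices; the rotations by 0, 3, 6, … of each cycle's base point
-- attain this bound.
module Submission where

open import Defs
open import Data.Nat using (ℕ; zero; suc; _+_; _*_; _∸_; _≤_; _<_; _%_; _/_; _!; z≤n; s≤s; _<?_; NonZero)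
open import Data.Nat.Properties
  using ( +-comm; +-assoc; +-identityʳ; *-comm; *-suc; *-cancelʳ-≡; ≤-trans; ≤-pred; ≤-antisym; <-trans; <-irrefl
        ; <-cmp; <⇒≱; ≮⇒≥; n<1+n; 1+n≰n; m∸n≤m; +-mono-≤; +-monoʳ-<; +-cancelˡ-<; *-monoˡ-≤; module ≤-Reasoning)
open import Data.Nat.DivMod
  using (_mod_; m%n<n; m%n%n≡m%n; %-distribˡ-+; m*n%n≡0; n%n≡0; m<n⇒m%n≡m; m/n*n≤m; m*n/n≡m; /-monoˡ-≤)
open import Data.Fin using (Fin; zero; suc; toℕ; fromℕ<; inject₁; punchOut)
open import Data.Fin.Properties
  using (toℕ-injective; toℕ-fromℕ<; toℕ<n; toℕ-inject₁; suc-injective; _≟_; any?; injective⇒≤; punchOut-injective)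
open import Data.Vec as Vec using (Vec; []; _∷_; lookup; tabulate)
open import Data.Vec.Properties
  using (lookup∘tabulate; tabulate∘lookup; tabulate-cong; lookup-map; ∷-injectiveˡ; ∷-injectiveʳ; ≡-dec)
open import Data.List as List using (List; []; _∷_; _++_; length; concatMap; allFin)
open import Data.List.Properties using (length-++; length-++-sucʳ; length-map; length-tabulate)
open import Data.List.Membership.Propositional using (_∈_; find; lose)
open import Data.List.Membership.Propositional.Properties
  using ( ∈-++⁺ˡ; ∈-++⁺ʳ; ∈-++⁻; ∈-∃++; ∈-map⁺; ∈-map⁻; ∈-concatMap⁺; ∈-concatMap⁻
        ; ∈-allFin; ∈-tabulate⁺; ∈-filter⁺; ∈-filter⁻)
open import Data.List.Relation.Unary.Any using (here; there)
import Data.List.Relation.Unary.All as All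
open import Data.List.Relation.Unary.AllPairs using ([]; _∷_)
open import Data.List.Relation.Unary.Unique.Propositional using (Unique)
open import Data.List.Relation.Unary.Unique.Propositional.Properties using (++⁺; map⁺; allFin⁺; tabulate⁺; filter⁺)
open import Data.List.Relation.Binary.Disjoint.Propositional using (Disjoint)
open import Data.List.Relation.Binary.Subset.Propositional using (_⊆_)
open import Data.Product using (_×_; _,_; ∃; ∃₂; proj₁; proj₂)
open import Data.Sum using (_⊎_; inj₁; inj₂)
open import Function using (_∘_; id)
open import Function.Definitions using (Injective)
open import Relation.Binary using (tri<; tri≈; tri>)
open import Relation.Binary.PropositionalEquality
open import Relation.Nullary using (yes; no; contradiction)

[m%n+k]%n≡[m+k]%n : ∀ x k n .{{_ : NonZero n}} → (x % n + k) % n ≡ (x + k) % n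
[m%n+k]%n≡[m+k]%n x k n = begin
  (x % n + k) % n          ≡⟨ %-distribˡ-+ (x % n) k n ⟩
  (x % n % n + k % n) % n  ≡⟨ cong (λ y → (y + k % n) % n) (m%n%n≡m%n x n) ⟩
  (x % n + k % n) % n      ≡⟨ %-distribˡ-+ x k n ⟨
  (x + k) % n              ∎
  where open ≡-Reasoning

-- suc j * suc k unfolds definitionally to suc (k + j * suc k).
[1+j]*[1+k]≤n+k⇒j*[1+k]<n : ∀ j k n → suc j * suc k ≤ n + k → j * suc k < n
[1+j]*[1+k]≤n+k⇒j*[1+k]<n j k n le = +-cancelˡ-< k (j * suc k) n (subst (suc j * suc k ≤_) (+-comm n k) le)

j*[1+k]<n⇒[1+j]*[1+k]≤n+k : ∀ j k n → j * suc k < n → suc j * suc k ≤ n + k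
j*[1+k]<n⇒[1+j]*[1+k]≤n+k j k n lt = subst (suc j * suc k ≤_) (+-comm k n) (+-monoʳ-< k lt)

m<[n+k]/[1+k]⇒m*[1+k]<n : ∀ {m k n} → m < (n + k) / suc k → m * suc k < n
m<[n+k]/[1+k]⇒m*[1+k]<n {m} {k} {n} lt =
  [1+j]*[1+k]≤n+k⇒j*[1+k]<n m k n (≤-trans (*-monoˡ-≤ (suc k) lt) (m/n*n≤m (n + k) (suc k)))

m*[1+k]<n⇒m<[n+k]/[1+k] : ∀ {m k n} → m * suc k < n → m < (n + k) / suc k
m*[1+k]<n⇒m<[n+k]/[1+k] {m} {k} {n} lt =
  subst (_≤ (n + k) / suc k) (m*n/n≡m (suc m) (suc k)) (/-monoˡ-≤ (suc k) (j*[1+k]<n⇒[1+j]*[1+k]≤n+k m k n lt))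

n≤m*[1+k]⇒[n+k]/[1+k]≤m : ∀ {m k n} → n ≤ m * suc k → (n + k) / suc k ≤ m
n≤m*[1+k]⇒[n+k]/[1+k]≤m le = ≮⇒≥ λ m<[n+k]/[1+k] → <⇒≱ (m<[n+k]/[1+k]⇒m*[1+k]<n m<[n+k]/[1+k]) le

divMod3 : ∀ n → ∃ λ j → n ≡ j * 3 ⊎ n ≡ 1 + j * 3 ⊎ n ≡ 2 + j * 3
divMod3 zero    = 0 , inj₁ refl
divMod3 (suc n) with divMod3 n
... | j , inj₁ refl        = j , inj₂ (inj₁ refl)
... | j , inj₂ (inj₁ refl) = j , inj₂ (inj₂ refl)
... | j , inj₂ (inj₂ refl) = suc j , inj₁ refl

module _ {A B : Set} where

  length-concatMap : ∀ (f : A → List B) k xs → (∀ x → length (f x) ≡ k) → length (concatMap f xs) ≡ length xs * k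
  length-concatMap f k []       _   = refl
  length-concatMap f k (x ∷ xs) |f| = trans (length-++ (f x)) (cong₂ _+_ (|f| x) (length-concatMap f k xs |f|))

  length-concatMap-≥ : ∀ (f : A → List B) k xs → (∀ {x} → x ∈ xs → k ≤ length (f x)) →
                       length xs * k ≤ length (concatMap f xs)
  length-concatMap-≥ f k []       _   = z≤n
  length-concatMap-≥ f k (x ∷ xs) |f| = subst (k + length xs * k ≤_) (sym (length-++ (f x)))
    (+-mono-≤ (|f| (here refl)) (length-concatMap-≥ f k xs (|f| ∘ there)))

module _ {A B : Set} where

  dependentProduct : List A → (A → List B) → List (A × B)
  dependentProduct xs f = concatMap (λ x → List.map (x ,_) (f x)) xs

  ∈-dependentProduct⁺ : ∀ {xs f x y} → x ∈ xs → y ∈ f x → (x , y) ∈ dependentProduct xs f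
  ∈-dependentProduct⁺ {f = f} x∈xs y∈fx = ∈-concatMap⁺ (λ x → List.map (x ,_) (f x)) (lose x∈xs (∈-map⁺ _ y∈fx))

  ∈-dependentProduct⁻ : ∀ xs {f x y} → (x , y) ∈ dependentProduct xs f → x ∈ xs × y ∈ f x
  ∈-dependentProduct⁻ xs {f} xy∈
    with x , x∈xs , xy∈′ ← find (∈-concatMap⁻ (λ x → List.map (x ,_) (f x)) {xs = xs} xy∈)
    with y , y∈fx , refl ← ∈-map⁻ (x ,_) xy∈′
    = x∈xs , y∈fx

  dependentProduct⁺ : ∀ {xs f} → Unique xs → (∀ x → Unique (f x)) → Unique (dependentProduct xs f)
  dependentProduct⁺ {[]}         _            _  = []
  dependentProduct⁺ {x ∷ xs} {f} (x∉xs ∷ xs!) f! =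
    ++⁺ (map⁺ (cong proj₂) (f! x)) (dependentProduct⁺ xs! f!) disjoint
    where
    disjoint : Disjoint (List.map (x ,_) (f x)) (dependentProduct xs f)
    disjoint (v∈ , v∈′) with y , _ , refl ← ∈-map⁻ (x ,_) v∈ =
      All.lookup x∉xs (proj₁ (∈-dependentProduct⁻ xs v∈′)) refl

  length-dependentProduct : ∀ xs (f : A → List B) k → (∀ x → length (f x) ≡ k) →
                            length (dependentProduct xs f) ≡ length xs * k
  length-dependentProduct xs f k |f| =
    length-concatMap (λ x → List.map (x ,_) (f x)) k xs λ x → trans (length-map (x ,_) (f x)) (|f| x)

  length-dependentProduct-≥ : ∀ xs (f : A → List B) k → (∀ {x} → x ∈ xs → k ≤ length (f x)) →
                              length xs * k ≤ length (dependentProduct xs f)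
  length-dependentProduct-≥ xs f k |f| =
    length-concatMap-≥ (λ x → List.map (x ,_) (f x)) k xs λ {x} x∈ → subst (k ≤_) (sym (length-map (x ,_) (f x))) (|f| x∈)

Unique⇒length≤ : ∀ {A : Set} {xs ys : List A} → Unique xs → xs ⊆ ys → length xs ≤ length ys
Unique⇒length≤ {xs = []}     _            _  = z≤n
Unique⇒length≤ {xs = x ∷ xs} (x∉xs ∷ xs!) xs⊆ys
  with as , bs , refl ← ∈-∃++ (xs⊆ys (here refl)) =
  subst (suc (length xs) ≤_) (sym (length-++-sucʳ as x bs)) (s≤s (Unique⇒length≤ xs! xs⊆as++bs))
  where
  xs⊆as++bs : xs ⊆ as ++ bs
  xs⊆as++bs {y} y∈xs with ∈-++⁻ as (xs⊆ys (there y∈xs))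
  ... | inj₁ y∈as         = ∈-++⁺ˡ y∈as
  ... | inj₂ (here refl)  = contradiction refl (All.lookup x∉xs y∈xs)
  ... | inj₂ (there y∈bs) = ∈-++⁺ʳ as y∈bs

injective⇒surjective : ∀ {n} {f : Fin n → Fin n} → Injective _≡_ _≡_ f → ∀ y → ∃ λ x → f x ≡ y
injective⇒surjective {suc n} {f} f-inj y with any? (λ x → f x ≟ y)
... | yes found = found
... | no  missed = contradiction (injective⇒≤ g-injective) 1+n≰n
  where
  y≢f : ∀ x → y ≢ f x
  y≢f x y≡fx = missed (x , sym y≡fx)
  g : Fin (suc n) → Fin n
  g x = punchOut (y≢f x)
  g-injective : Injective _≡_ _≡_ g
  g-injective {x} {x′} eq = f-inj (punchOut-injective (y≢f x) (y≢f x′) eq)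

Distinct : ∀ {A : Set} {n} → Vec A n → Set
Distinct v = Injective _≡_ _≡_ (lookup v)

map-injective : ∀ {A B : Set} {f : A → B} {n} → Injective _≡_ _≡_ f → Injective _≡_ _≡_ (Vec.map {n = n} f)
map-injective f-inj {[]}    {[]}    _  = refl
map-injective f-inj {x ∷ p} {y ∷ q} eq = cong₂ _∷_ (f-inj (∷-injectiveˡ eq)) (map-injective f-inj (∷-injectiveʳ eq))

≢zero⇒map-suc : ∀ {n k} (t : Vec (Fin (suc n)) k) → (∀ j → lookup t j ≢ zero) → ∃ λ q → t ≡ Vec.map suc q
≢zero⇒map-suc []          _  = [] , refl
≢zero⇒map-suc (zero ∷ t)  nz = contradiction refl (nz zero)
≢zero⇒map-suc (suc x ∷ t) nz with q , refl ← ≢zero⇒map-suc t (nz ∘ suc) = x ∷ q , refl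

module _ {m : ℕ} where

  infixl 6 _⊕_

  _⊕_ : Fin (suc m) → ℕ → Fin (suc m)
  i ⊕ k = (toℕ i + k) mod suc m

  toℕ-mod : ∀ a → toℕ (a mod suc m) ≡ a % suc m
  toℕ-mod a = toℕ-fromℕ< (m%n<n a (suc m))

  toℕ-⊕ : ∀ i k → toℕ (i ⊕ k) ≡ (toℕ i + k) % suc m
  toℕ-⊕ i k = toℕ-mod (toℕ i + k)

  toℕ-⊕-< : ∀ i k → toℕ i + k < suc m → toℕ (i ⊕ k) ≡ toℕ i + k
  toℕ-⊕-< i k lt = trans (toℕ-⊕ i k) (m<n⇒m%n≡m lt)

  ⊕-cong : ∀ i {a b} → a % suc m ≡ b % suc m → i ⊕ a ≡ i ⊕ b
  ⊕-cong i {a} {b} eq = toℕ-injective (begin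
    toℕ (i ⊕ a)                          ≡⟨ toℕ-⊕ i a ⟩
    (toℕ i + a) % suc m                  ≡⟨ %-distribˡ-+ (toℕ i) a (suc m) ⟩
    (toℕ i % suc m + a % suc m) % suc m  ≡⟨ cong (λ x → (toℕ i % suc m + x) % suc m) eq ⟩
    (toℕ i % suc m + b % suc m) % suc m  ≡⟨ %-distribˡ-+ (toℕ i) b (suc m) ⟨
    (toℕ i + b) % suc m                  ≡⟨ toℕ-⊕ i b ⟨
    toℕ (i ⊕ b)                          ∎)
    where open ≡-Reasoning

  ⊕-⊕ : ∀ i a b → i ⊕ a ⊕ b ≡ i ⊕ (a + b)
  ⊕-⊕ i a b = toℕ-injective (begin
    toℕ (i ⊕ a ⊕ b)                    ≡⟨ toℕ-⊕ (i ⊕ a) b ⟩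
    (toℕ (i ⊕ a) + b) % suc m          ≡⟨ cong (λ x → (x + b) % suc m) (toℕ-⊕ i a) ⟩
    ((toℕ i + a) % suc m + b) % suc m  ≡⟨ [m%n+k]%n≡[m+k]%n (toℕ i + a) b (suc m) ⟩
    (toℕ i + a + b) % suc m            ≡⟨ cong (_% suc m) (+-assoc (toℕ i) a b) ⟩
    (toℕ i + (a + b)) % suc m          ≡⟨ toℕ-⊕ i (a + b) ⟨
    toℕ (i ⊕ (a + b))                  ∎)
    where open ≡-Reasoning

  ⊕-identityʳ : ∀ i → i ⊕ 0 ≡ i
  ⊕-identityʳ i = toℕ-injective (trans (toℕ-⊕-< i 0 i+0<n) (+-identityʳ (toℕ i)))
    where i+0<n = subst (_< suc m) (sym (+-identityʳ (toℕ i))) (toℕ<n i)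

  ⊕-comm : ∀ i j → i ⊕ toℕ j ≡ j ⊕ toℕ i
  ⊕-comm i j = cong (_mod suc m) (+-comm (toℕ i) (toℕ j))

  zero-⊕ : ∀ i → zero ⊕ toℕ i ≡ i
  zero-⊕ i = trans (⊕-comm zero i) (⊕-identityʳ i)

  ⊕-⊕-≡ : ∀ i a b → (a + b) % suc m ≡ 0 → i ⊕ a ⊕ b ≡ i
  ⊕-⊕-≡ i a b eq = begin
    i ⊕ a ⊕ b    ≡⟨ ⊕-⊕ i a b ⟩
    i ⊕ (a + b)  ≡⟨ ⊕-cong i eq ⟩
    i ⊕ 0        ≡⟨ ⊕-identityʳ i ⟩
    i            ∎
    where open ≡-Reasoning

  [k+k*m]%[1+m]≡0 : ∀ k → (k + k * m) % suc m ≡ 0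
  [k+k*m]%[1+m]≡0 k = trans (cong (_% suc m) (sym (*-suc k m))) (m*n%n≡0 k (suc m))

  [k*m+k]%[1+m]≡0 : ∀ k → (k * m + k) % suc m ≡ 0
  [k*m+k]%[1+m]≡0 k = trans (cong (_% suc m) (+-comm (k * m) k)) ([k+k*m]%[1+m]≡0 k)

  [m+1]%[1+m]≡0 : (m + 1) % suc m ≡ 0
  [m+1]%[1+m]≡0 = trans (cong (_% suc m) (+-comm m 1)) (n%n≡0 (suc m))

  ⊕-injectiveˡ : ∀ k → Injective _≡_ _≡_ (_⊕ k)
  ⊕-injectiveˡ k {i} {j} eq = begin
    i                ≡⟨ ⊕-⊕-≡ i k (k * m) ([k+k*m]%[1+m]≡0 k) ⟨
    i ⊕ k ⊕ (k * m)  ≡⟨ cong (_⊕ (k * m)) eq ⟩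
    j ⊕ k ⊕ (k * m)  ≡⟨ ⊕-⊕-≡ j k (k * m) ([k+k*m]%[1+m]≡0 k) ⟩
    j                ∎
    where open ≡-Reasoning

  ⊕1-suc : ∀ i j → suc (toℕ j) ≡ toℕ i → j ⊕ 1 ≡ i
  ⊕1-suc i j eq = toℕ-injective (begin
    toℕ (j ⊕ 1)  ≡⟨ toℕ-⊕-< j 1 (subst (_< suc m) (trans (sym eq) (+-comm 1 (toℕ j))) (toℕ<n i)) ⟩
    toℕ j + 1    ≡⟨ +-comm (toℕ j) 1 ⟩
    suc (toℕ j)  ≡⟨ eq ⟩
    toℕ i        ∎)
    where open ≡-Reasoning

  ⊕1-last : ∀ j → toℕ j ≡ m → j ⊕ 1 ≡ zero
  ⊕1-last j eq = toℕ-injective (trans (toℕ-⊕ j 1) (trans (cong (λ k → (k + 1) % suc m) eq) [m+1]%[1+m]≡0))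

  rotate : ∀ {A : Set} → ℕ → Vec A (suc m) → Vec A (suc m)
  rotate k v = tabulate (λ i → lookup v (i ⊕ k))

  module _ {A : Set} where

    lookup-rotate : ∀ k (v : Vec A (suc m)) i → lookup (rotate k v) i ≡ lookup v (i ⊕ k)
    lookup-rotate k v = lookup∘tabulate (λ i → lookup v (i ⊕ k))

    rotate-rotate : ∀ a b (v : Vec A (suc m)) → rotate a (rotate b v) ≡ rotate (a + b) v
    rotate-rotate a b v = tabulate-cong λ i → trans (lookup-rotate b v (i ⊕ a)) (cong (lookup v) (⊕-⊕ i a b))

    rotate-cong : ∀ {a b} (v : Vec A (suc m)) → a % suc m ≡ b % suc m → rotate a v ≡ rotate b v
    rotate-cong {a} {b} v eq = tabulate-cong λ i → cong (lookup v) (⊕-cong i {a} {b} eq)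

    rotate-inverse : ∀ {a b} (v : Vec A (suc m)) → (a + b) % suc m ≡ 0 → rotate a (rotate b v) ≡ v
    rotate-inverse {a} {b} v eq = begin
      rotate a (rotate b v)                  ≡⟨ tabulate-cong (λ i → lookup-rotate b v (i ⊕ a)) ⟩
      tabulate (λ i → lookup v (i ⊕ a ⊕ b))  ≡⟨ tabulate-cong (λ i → cong (lookup v) (⊕-⊕-≡ i a b eq)) ⟩
      tabulate (lookup v)                    ≡⟨ tabulate∘lookup v ⟩
      v                                      ∎
      where open ≡-Reasoning

    rotate-Distinct : ∀ k (v : Vec A (suc m)) → Distinct v → Distinct (rotate k v)
    rotate-Distinct k v v! {i} {j} eq = ⊕-injectiveˡ k (v! (begin
      lookup v (i ⊕ k)       ≡⟨ lookup-rotate k v i ⟨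
      lookup (rotate k v) i  ≡⟨ eq ⟩
      lookup (rotate k v) j  ≡⟨ lookup-rotate k v j ⟩
      lookup v (j ⊕ k)       ∎))
      where open ≡-Reasoning

  zeroFirst : Vec (Fin m) m → Vec (Fin (suc m)) (suc m)
  zeroFirst q = zero ∷ Vec.map suc q

  zeroFirst-zero⇒zero : ∀ q {i} → lookup (zeroFirst q) i ≡ zero → i ≡ zero
  zeroFirst-zero⇒zero q {zero}  _  = refl
  zeroFirst-zero⇒zero q {suc j} eq = contradiction (trans (sym (lookup-map j suc q)) eq) λ ()

  zeroFirst-Distinct : ∀ q → Distinct q → Distinct (zeroFirst q)
  zeroFirst-Distinct q q! {zero}  {zero}  _  = refl
  zeroFirst-Distinct q q! {zero}  {suc j} eq = contradiction (trans eq (lookup-map j suc q)) λ ()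
  zeroFirst-Distinct q q! {suc i} {zero}  eq = contradiction (trans (sym (lookup-map i suc q)) eq) λ ()
  zeroFirst-Distinct q q! {suc i} {suc j} eq =
    cong suc (q! (suc-injective (trans (sym (lookup-map i suc q)) (trans eq (lookup-map j suc q)))))

  zeroFirst-complete : ∀ (u : Vec (Fin (suc m)) (suc m)) → lookup u zero ≡ zero → Distinct u → ∃ λ q → Distinct q × u ≡ zeroFirst q
  zeroFirst-complete (.zero ∷ t) refl u!
    with q , refl ← ≢zero⇒map-suc t (λ j eq → contradiction (u! {suc j} {zero} eq) λ ())
    = q , q! , refl
    where
    q! : Distinct q
    q! {i} {j} eq = suc-injective (u! {suc i} {suc j}
      (trans (lookup-map i suc q) (trans (cong suc eq) (sym (lookup-map j suc q)))))

  -- Every vertex has exactly one such form: q lists, decremented, the entries that cyclically follow zero.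
  encode : Vec (Fin m) m × Fin (suc m) → Vec (Fin (suc m)) (suc m)
  encode (q , r) = rotate (toℕ r) (zeroFirst q)

  encode-Distinct : ∀ (q : Vec (Fin m) m) r → Distinct q → Distinct (encode (q , r))
  encode-Distinct q r q! = rotate-Distinct (toℕ r) (zeroFirst q) (zeroFirst-Distinct q q!)

  rotate-encode : ∀ k (q : Vec (Fin m) m) r → rotate k (encode (q , r)) ≡ encode (q , r ⊕ k)
  rotate-encode k q r = trans (rotate-rotate k (toℕ r) (zeroFirst q)) (rotate-cong (zeroFirst q) (begin
    (k + toℕ r) % suc m          ≡⟨ cong (_% suc m) (+-comm k (toℕ r)) ⟩
    (toℕ r + k) % suc m          ≡⟨ m%n%n≡m%n (toℕ r + k) (suc m) ⟨
    (toℕ r + k) % suc m % suc m  ≡⟨ cong (_% suc m) (toℕ-⊕ r k) ⟨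
    toℕ (r ⊕ k) % suc m          ∎))
    where open ≡-Reasoning

  encode-injective : Injective _≡_ _≡_ encode
  encode-injective {q , r} {q′ , r′} eq = cong₂ _,_ q≡q′ r≡r′
    where
    open ≡-Reasoning
    unrotate : ∀ p s → rotate (toℕ s * m) (encode (p , s)) ≡ zeroFirst p
    unrotate p s = rotate-inverse (zeroFirst p) ([k*m+k]%[1+m]≡0 (toℕ s))
    p : Fin (suc m)
    p = zero ⊕ (toℕ r * m)
    -- both encode (q , r) and encode (q′ , r′) have their zero at position p
    p⊕r′≡zero : p ⊕ toℕ r′ ≡ zero
    p⊕r′≡zero = zeroFirst-zero⇒zero q′ (begin
      lookup (zeroFirst q′) (p ⊕ toℕ r′)                   ≡⟨ lookup-rotate (toℕ r′) (zeroFirst q′) p ⟨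
      lookup (encode (q′ , r′)) p                          ≡⟨ lookup-rotate (toℕ r * m) (encode (q′ , r′)) zero ⟨
      lookup (rotate (toℕ r * m) (encode (q′ , r′))) zero  ≡⟨ cong (λ v → lookup (rotate (toℕ r * m) v) zero) eq ⟨
      lookup (rotate (toℕ r * m) (encode (q , r))) zero    ≡⟨ cong (λ v → lookup v zero) (unrotate q r) ⟩
      zero                                                 ∎)
    r≡r′ : r ≡ r′
    r≡r′ = ⊕-injectiveˡ (toℕ p) (begin
      r ⊕ toℕ p   ≡⟨ ⊕-comm r p ⟩
      p ⊕ toℕ r   ≡⟨ ⊕-⊕-≡ zero (toℕ r * m) (toℕ r) ([k*m+k]%[1+m]≡0 (toℕ r)) ⟩
      zero        ≡⟨ p⊕r′≡zero ⟨
      p ⊕ toℕ r′  ≡⟨ ⊕-comm p r′ ⟩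
      r′ ⊕ toℕ p  ∎)
    q≡q′ : q ≡ q′
    q≡q′ = map-injective suc-injective (∷-injectiveʳ (begin
      zeroFirst q                           ≡⟨ unrotate q r ⟨
      rotate (toℕ r * m) (encode (q , r))   ≡⟨ cong (rotate (toℕ r * m)) (trans eq (cong (λ s → encode (q′ , s)) (sym r≡r′))) ⟩
      rotate (toℕ r * m) (encode (q′ , r))  ≡⟨ unrotate q′ r ⟩
      zeroFirst q′                          ∎))

  encode-surjective : ∀ (w : Vec (Fin (suc m)) (suc m)) → Distinct w → ∃₂ λ q r → Distinct q × w ≡ encode (q , r)
  encode-surjective w w!
    with i , wᵢ≡zero ← injective⇒surjective w! zero
    with q , q! , rotated≡zeroFirst ← zeroFirst-complete (rotate (toℕ i) w)
           (trans (lookup-rotate (toℕ i) w zero) (trans (cong (lookup w) (zero-⊕ i)) wᵢ≡zero))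
           (rotate-Distinct (toℕ i) w w!)
    = q , (toℕ i * m) mod suc m , q! , (begin
      w                                      ≡⟨ rotate-inverse w ([k*m+k]%[1+m]≡0 (toℕ i)) ⟨
      rotate (toℕ i * m) (rotate (toℕ i) w)  ≡⟨ cong (rotate (toℕ i * m)) rotated≡zeroFirst ⟩
      rotate (toℕ i * m) (zeroFirst q)       ≡⟨ rotate-cong (zeroFirst q) i*m≡r ⟩
      encode (q , (toℕ i * m) mod suc m)     ∎)
    where
    open ≡-Reasoning
    i*m≡r : toℕ i * m % suc m ≡ toℕ ((toℕ i * m) mod suc m) % suc m
    i*m≡r = sym (trans (cong (_% suc m) (toℕ-mod (toℕ i * m))) (m%n%n≡m%n (toℕ i * m) (suc m)))

permutations : ∀ n → List (Vec (Fin n) n)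
permutations zero    = [] ∷ []
permutations (suc m) = List.map encode (dependentProduct (permutations m) (λ _ → allFin (suc m)))

∈-permutations⁻ : ∀ n {v} → v ∈ permutations n → Distinct v
∈-permutations⁻ zero    _  {()}
∈-permutations⁻ (suc m) v∈ with (q , r) , qr∈ , refl ← ∈-map⁻ encode v∈ =
  encode-Distinct q r (∈-permutations⁻ m (proj₁ (∈-dependentProduct⁻ (permutations m) qr∈)))

∈-permutations⁺ : ∀ n {v} → Distinct v → v ∈ permutations n
∈-permutations⁺ zero    {[]} _ = here refl
∈-permutations⁺ (suc m) {v} v! =
  let q , r , q! , v≡ = encode-surjective v v! in
  subst (_∈ permutations (suc m)) (sym v≡)
    (∈-map⁺ encode (∈-dependentProduct⁺ {f = λ _ → allFin (suc m)} (∈-permutations⁺ m q!) (∈-allFin r)))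

permutations⁺ : ∀ n → Unique (permutations n)
permutations⁺ zero    = All.[] ∷ []
permutations⁺ (suc m) = map⁺ encode-injective (dependentProduct⁺ (permutations⁺ m) (λ _ → allFin⁺ (suc m)))

length-permutations : ∀ n → length (permutations n) ≡ n !
length-permutations zero    = refl
length-permutations (suc m) = begin
  length (List.map encode pairs)  ≡⟨ length-map encode pairs ⟩
  length pairs                    ≡⟨ length-dependentProduct (permutations m) _ (suc m) (λ _ → length-tabulate {n = suc m} id) ⟩
  length (permutations m) * suc m ≡⟨ cong (_* suc m) (length-permutations m) ⟩
  m ! * suc m                     ≡⟨ *-comm (m !) (suc m) ⟩
  suc m !                         ∎
  where
  open ≡-Reasoning
  pairs = dependentProduct (permutations m) (λ _ → allFin (suc m))

module _ {d n : ℕ} where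

  TConstrained⇒Distinct : (x : Seq d n) → TConstrained n x → Distinct x
  TConstrained⇒Distinct x tc {i} {j} eq with <-cmp (toℕ i) (toℕ j)
  ... | tri< i<j _ _ = contradiction (≤-trans (tc i j i<j eq) (m∸n≤m (toℕ j) (toℕ i))) (<⇒≱ (toℕ<n j))
  ... | tri≈ _ i≡j _ = toℕ-injective i≡j
  ... | tri> _ _ j<i = contradiction (≤-trans (tc j i j<i (sym eq)) (m∸n≤m (toℕ i) (toℕ j))) (<⇒≱ (toℕ<n i))

  Distinct⇒TConstrained : (x : Seq d n) → Distinct x → TConstrained n x
  Distinct⇒TConstrained x x! i j i<j eq = contradiction (subst (λ k → toℕ k < toℕ j) (x! eq) i<j) (<-irrefl refl)

WithinOneStep : ∀ {X : Set} → (X → X) → X → X → Set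
WithinOneStep step x y = x ≡ y ⊎ y ≡ step x ⊎ x ≡ step y

module _ {m : ℕ} where

  Dominates : Seq (suc m) (suc m) → Seq (suc m) (suc m) → Set
  Dominates s w = s ≡ w ⊎ Adj (suc m) (suc m) (suc m) s w

  rotate-arc : ∀ (a : Seq (suc m) (suc m)) → Distinct a → Arc (suc m) (suc m) (suc m) a (rotate 1 a)
  rotate-arc a a! =
    Distinct⇒TConstrained a a! ,
    Distinct⇒TConstrained (rotate 1 a) (rotate-Distinct 1 a a!) ,
    λ i j eq → trans (cong (lookup a) (sym (⊕1-suc i j eq))) (sym (lookup-rotate 1 a j))

  arc⇒rotate : ∀ {a b} → Arc (suc m) (suc m) (suc m) a b → b ≡ rotate 1 a
  arc⇒rotate {a} {b} (a-tc , b-tc , shift) = trans (sym (tabulate∘lookup b)) (tabulate-cong b≗a∘⊕1)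
    where
    b≗a∘⊕1 : ∀ j → lookup b j ≡ lookup a (j ⊕ 1)
    b≗a∘⊕1 j with suc (toℕ j) <? suc m
    ... | yes j+1<n = sym (trans (cong (lookup a) (⊕1-suc _ j (sym (toℕ-fromℕ< j+1<n)))) (shift _ j (sym (toℕ-fromℕ< j+1<n))))
    ... | no  j+1≮n = lastEntry (≤-antisym (≤-pred (toℕ<n j)) (≤-pred (≮⇒≥ j+1≮n)))
                                (injective⇒surjective (TConstrained⇒Distinct a a-tc) (lookup b j))
      where
      -- bⱼ must be a₀, the only value of a not already used by b₀ … bₘ₋₁ = a₁ … aₘ
      lastEntry : toℕ j ≡ m → ∃ (λ x → lookup a x ≡ lookup b j) → lookup b j ≡ lookup a (j ⊕ 1)
      lastEntry j≡m (zero , a₀≡bⱼ)    = trans (sym a₀≡bⱼ) (cong (lookup a) (sym (⊕1-last j j≡m)))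
      lastEntry j≡m (suc t , aₜ₊₁≡bⱼ) = contradiction (trans (sym (toℕ-inject₁ t)) (trans (cong toℕ t≡j) j≡m))
                                                     (λ t≡m → <-irrefl t≡m (toℕ<n t))
        where
        t≡j : inject₁ t ≡ j
        t≡j = TConstrained⇒Distinct b b-tc (trans (sym (shift (suc t) (inject₁ t) (cong suc (toℕ-inject₁ t)))) aₜ₊₁≡bⱼ)

  rotate-≢ : 1 ≤ m → ∀ (w : Seq (suc m) (suc m)) → Distinct w → rotate 1 w ≢ w
  rotate-≢ 1≤m w w! eq = contradiction (trans (sym (toℕ-⊕-< zero 1 (s≤s 1≤m))) (cong toℕ zero⊕1≡zero)) λ ()
    where
    zero⊕1≡zero : zero ⊕ 1 ≡ zero
    zero⊕1≡zero = w! (trans (sym (lookup-rotate 1 w zero)) (cong (λ v → lookup v zero) eq))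

  Dominates⇒WithinOneStep : ∀ {s w : Seq (suc m) (suc m)} → Dominates s w → WithinOneStep (rotate 1) s w
  Dominates⇒WithinOneStep             (inj₁ s≡w)            = inj₁ s≡w
  Dominates⇒WithinOneStep {s = s} {w} (inj₂ (_ , inj₁ arc)) = inj₂ (inj₁ (arc⇒rotate {a = s} {b = w} arc))
  Dominates⇒WithinOneStep {s = s} {w} (inj₂ (_ , inj₂ arc)) = inj₂ (inj₂ (arc⇒rotate {a = w} {b = s} arc))

  WithinOneStep⇒Dominates : 1 ≤ m → ∀ {s w : Seq (suc m) (suc m)} → Distinct s → Distinct w → WithinOneStep (rotate 1) s w → Dominates s w
  WithinOneStep⇒Dominates _   _         _  (inj₁ s≡w)         = inj₁ s≡w
  WithinOneStep⇒Dominates 1≤m {s}    s! _  (inj₂ (inj₁ refl)) = inj₂ (rotate-≢ 1≤m s s! ∘ sym , inj₁ (rotate-arc s s!))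
  WithinOneStep⇒Dominates 1≤m {w = w} _ w! (inj₂ (inj₂ refl)) = inj₂ (rotate-≢ 1≤m w w! , inj₂ (rotate-arc w w!))

  encode-WithinOneStep : ∀ (q : Vec (Fin m) m) {o r} → WithinOneStep (_⊕ 1) o r → WithinOneStep (rotate 1) (encode (q , o)) (encode (q , r))
  encode-WithinOneStep q         (inj₁ refl)        = inj₁ refl
  encode-WithinOneStep q {o}     (inj₂ (inj₁ refl)) = inj₂ (inj₁ (sym (rotate-encode 1 q o)))
  encode-WithinOneStep q {r = r} (inj₂ (inj₂ refl)) = inj₂ (inj₂ (sym (rotate-encode 1 q r)))

  WithinOneStep-encode : ∀ (q : Vec (Fin m) m) r {s} → WithinOneStep (rotate 1) s (encode (q , r)) →
                         ∃ λ o → s ≡ encode (q , o) × WithinOneStep (_⊕ 1) o r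
  WithinOneStep-encode q r     (inj₁ s≡w)         = r , s≡w , inj₁ refl
  WithinOneStep-encode q r {s} (inj₂ (inj₁ w≡s⁺)) =
    r ⊕ m , s≡ , inj₂ (inj₁ (sym (⊕-⊕-≡ r m 1 ([m+1]%[1+m]≡0 {m}))))
    where
    s≡ : s ≡ encode (q , r ⊕ m)
    s≡ = trans (sym (rotate-inverse s ([m+1]%[1+m]≡0 {m}))) (trans (cong (rotate m) (sym w≡s⁺)) (rotate-encode m q r))
  WithinOneStep-encode q r     (inj₂ (inj₂ s≡w⁺)) = r ⊕ 1 , trans s≡w⁺ (rotate-encode 1 q r) , inj₂ (inj₂ refl)

  DominatesCycle : List (Fin (suc m)) → Set
  DominatesCycle D = ∀ r → ∃ λ o → o ∈ D × WithinOneStep (_⊕ 1) o r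

  closedNbhd : Fin (suc m) → List (Fin (suc m))
  closedNbhd o = o ∷ o ⊕ 1 ∷ o ⊕ m ∷ []

  WithinOneStep⇒∈closedNbhd : ∀ {o r} → WithinOneStep (_⊕ 1) o r → r ∈ closedNbhd o
  WithinOneStep⇒∈closedNbhd         (inj₁ refl)        = here refl
  WithinOneStep⇒∈closedNbhd         (inj₂ (inj₁ refl)) = there (here refl)
  WithinOneStep⇒∈closedNbhd {r = r} (inj₂ (inj₂ refl)) = there (there (here (sym (⊕-⊕-≡ r 1 m (n%n≡0 (suc m))))))

  DominatesCycle⇒[n+2]/3≤length : ∀ D → DominatesCycle D → (suc m + 2) / 3 ≤ length D
  DominatesCycle⇒[n+2]/3≤length D D-dom = n≤m*[1+k]⇒[n+k]/[1+k]≤m {k = 2} (begin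
    suc m                            ≡⟨ length-tabulate id ⟨
    length (allFin (suc m))          ≤⟨ Unique⇒length≤ (allFin⁺ (suc m)) covered ⟩
    length (concatMap closedNbhd D)  ≡⟨ length-concatMap closedNbhd 3 D (λ _ → refl) ⟩
    length D * 3                     ∎)
    where
    open ≤-Reasoning
    covered : allFin (suc m) ⊆ concatMap closedNbhd D
    covered {r} _ with o , o∈D , near ← D-dom r = ∈-concatMap⁺ closedNbhd (lose o∈D (WithinOneStep⇒∈closedNbhd near))

  offset : Fin ((suc m + 2) / 3) → Fin (suc m)
  offset j = fromℕ< (m<[n+k]/[1+k]⇒m*[1+k]<n {k = 2} {n = suc m} (toℕ<n j))

  toℕ-offset : ∀ j → toℕ (offset j) ≡ toℕ j * 3
  toℕ-offset j = toℕ-fromℕ< _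

  offsets : List (Fin (suc m))
  offsets = List.tabulate offset

  offsets⁺ : Unique offsets
  offsets⁺ = tabulate⁺ λ {i} {j} eq → toℕ-injective (*-cancelʳ-≡ (toℕ i) (toℕ j) 3
    (trans (sym (toℕ-offset i)) (trans (cong toℕ eq) (toℕ-offset j))))

  offset-of : ∀ j → j * 3 < suc m → ∃ λ o → o ∈ offsets × toℕ o ≡ j * 3
  offset-of j lt = offset (fromℕ< j<K) , ∈-tabulate⁺ (fromℕ< j<K) ,
    trans (toℕ-offset (fromℕ< j<K)) (cong (_* 3) (toℕ-fromℕ< j<K))
    where j<K = m*[1+k]<n⇒m<[n+k]/[1+k] {j} {2} {suc m} lt

  offsets-dominate : DominatesCycle offsets
  offsets-dominate r with divMod3 (toℕ r)
  ... | j , inj₁ r≡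
    with o , o∈ , o≡ ← offset-of j (subst (_< suc m) r≡ (toℕ<n r))
    = o , o∈ , inj₁ (toℕ-injective (trans o≡ (sym r≡)))
  ... | j , inj₂ (inj₁ r≡)
    with o , o∈ , o≡ ← offset-of j (<-trans (n<1+n (j * 3)) (subst (_< suc m) r≡ (toℕ<n r)))
    = o , o∈ , inj₂ (inj₁ (sym (⊕1-suc r o (trans (cong suc o≡) (sym r≡)))))
  ... | j , inj₂ (inj₂ r≡) with suc j * 3 <? suc m
  ...   | yes lt
    with o , o∈ , o≡ ← offset-of (suc j) lt
    = o , o∈ , inj₂ (inj₂ (sym (⊕1-suc o r (trans (cong suc r≡) (sym o≡)))))
  ...   | no 3j+3≮n
    with o , o∈ , o≡ ← offset-of 0 (s≤s z≤n)
    = o , o∈ , inj₂ (inj₂ (trans (toℕ-injective o≡) (sym (⊕1-last r r≡m))))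
    where r≡m = ≤-antisym (≤-pred (toℕ<n r)) (≤-pred (subst (suc m ≤_) (cong suc (sym r≡)) (≮⇒≥ 3j+3≮n)))

module Bounds {m : ℕ} (1≤m : 1 ≤ m) where

  open import Data.List.Membership.DecPropositional (≡-dec {n = suc m} (_≟_ {suc m})) using (_∈?_)

  dominatingSet : List (Seq (suc m) (suc m))
  dominatingSet = List.map encode (dependentProduct (permutations m) (λ _ → offsets))

  dominatingSet⁺ : Unique dominatingSet
  dominatingSet⁺ = map⁺ encode-injective (dependentProduct⁺ (permutations⁺ m) (λ _ → offsets⁺))

  length-dominatingSet : length dominatingSet ≡ (suc m + 2) / 3 * m !
  length-dominatingSet = begin
    length (List.map encode pairs)               ≡⟨ length-map encode pairs ⟩
    length pairs                                 ≡⟨ length-dependentProduct (permutations m) _ _ (λ _ → length-tabulate (offset {m})) ⟩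
    length (permutations m) * ((suc m + 2) / 3)  ≡⟨ cong (_* ((suc m + 2) / 3)) (length-permutations m) ⟩
    m ! * ((suc m + 2) / 3)                      ≡⟨ *-comm (m !) _ ⟩
    (suc m + 2) / 3 * m !                        ∎
    where
    open ≡-Reasoning
    pairs = dependentProduct (permutations m) (λ _ → offsets)

  dominatingSet-Dominating : Dominating (suc m) (suc m) (suc m) dominatingSet
  dominatingSet-Dominating = vertices , dominated
    where
    vertices : ∀ s → s ∈ dominatingSet → InV (suc m) (suc m) (suc m) s
    vertices s s∈ with (q , o) , qo∈ , refl ← ∈-map⁻ encode s∈ =
      Distinct⇒TConstrained s (encode-Distinct q o (∈-permutations⁻ m (proj₁ (∈-dependentProduct⁻ (permutations m) qo∈))))
    dominated : ∀ w → InV (suc m) (suc m) (suc m) w → ∃ λ s → s ∈ dominatingSet × Dominates s w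
    dominated w w-tc =
      let q , r , q! , w≡ = encode-surjective w (TConstrained⇒Distinct w w-tc)
          o , o∈ , near = offsets-dominate r
      in encode (q , o) ,
         ∈-map⁺ encode (∈-dependentProduct⁺ {f = λ _ → offsets} (∈-permutations⁺ m q!) o∈) ,
         subst (Dominates (encode (q , o))) (sym w≡)
           (WithinOneStep⇒Dominates 1≤m (encode-Distinct q o q!) (encode-Distinct q r q!) (encode-WithinOneStep q near))

  module _ (S : List (Seq (suc m) (suc m))) (S! : Unique S) (S-dom : Dominating (suc m) (suc m) (suc m) S) where

    offsetsIn : Vec (Fin m) m → List (Fin (suc m))
    offsetsIn q = List.filter (λ r → encode (q , r) ∈? S) (allFin (suc m))

    offsetsIn-dominate : ∀ q → Distinct q → DominatesCycle (offsetsIn q)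
    offsetsIn-dominate q q! r =
      let s , s∈S , s-dom = proj₂ S-dom (encode (q , r)) (Distinct⇒TConstrained (encode (q , r)) (encode-Distinct q r q!))
          o , s≡ , near = WithinOneStep-encode q r (Dominates⇒WithinOneStep {s = s} {w = encode (q , r)} s-dom)
      in o , ∈-filter⁺ (λ r → encode (q , r) ∈? S) (∈-allFin o) (subst (_∈ S) s≡ s∈S) , near

    pairs : List (Vec (Fin m) m × Fin (suc m))
    pairs = dependentProduct (permutations m) offsetsIn

    encoded⊆S : List.map encode pairs ⊆ S
    encoded⊆S s∈ with (q , o) , qo∈ , refl ← ∈-map⁻ encode s∈ =
      proj₂ (∈-filter⁻ (λ r → encode (q , r) ∈? S) (proj₂ (∈-dependentProduct⁻ (permutations m) qo∈)))

    encoded⁺ : Unique (List.map encode pairs)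
    encoded⁺ = map⁺ encode-injective
      (dependentProduct⁺ (permutations⁺ m) (λ q → filter⁺ (λ r → encode (q , r) ∈? S) (allFin⁺ (suc m))))

    lower-bound : (suc m + 2) / 3 * m ! ≤ length S
    lower-bound = begin
      (suc m + 2) / 3 * m !                        ≡⟨ *-comm _ (m !) ⟩
      m ! * ((suc m + 2) / 3)                      ≡⟨ cong (_* ((suc m + 2) / 3)) (length-permutations m) ⟨
      length (permutations m) * ((suc m + 2) / 3)  ≤⟨ length-dependentProduct-≥ (permutations m) offsetsIn _ each-cycle ⟩
      length pairs                                 ≡⟨ length-map encode pairs ⟨
      length (List.map encode pairs)               ≤⟨ Unique⇒length≤ encoded⁺ encoded⊆S ⟩
      length S                                     ∎
      where
      open ≤-Reasoning
      each-cycle : ∀ {q} → q ∈ permutations m → (suc m + 2) / 3 ≤ length (offsetsIn q)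
      each-cycle {q} q∈ = DominatesCycle⇒[n+2]/3≤length (offsetsIn q) (offsetsIn-dominate q (∈-permutations⁻ m q∈))

theorem14 : (n : ℕ) → 2 ≤ n →
    DominationNumber n n n (((n + 2) / 3) * ((n ∸ 1) !))
theorem14 (suc (suc k)) (s≤s (s≤s _)) =
  (dominatingSet , dominatingSet⁺ , dominatingSet-Dominating , length-dominatingSet) , lower-bound
  where open Bounds {suc k} (s≤s z≤n)
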